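{- For $n\ge0$ let $Q_n=[0,n]^2$ (grid graph), $\underline{Q}=(Q_n)_{n\ge0}$, and let $k$ be a positive integer. Let $\underline{v}=(v_n)_{n\ge0}$ be a sequence of activated vertices in $\underline{Q}$ in which there are never more than $k$ consecutive $\bullet$'s, and such that $v_n=(n,n)$ whenever $v_n\neq\bullet$. Then the burning density exists and $\delta(\underline{Q},\underline{v})=1$.
   Context: $[0,n]^2$ denotes the graph on vertex set $[0,n]^2\subset\mathbb{Z}^2$ in which two vertices are adjacent iff their $L_1$-distance is $1$. Burning process: let $\underline{G}=(G_0,G_1,\dots)$ be graphs with $G_{n-1}$ an induced subgraph of $G_n$ for all $n\ge1$. A sequence of activated vertices is $\underline{v}=(v_n)_{n\ge0}$ with $v_n\in V(G_n)\cup\{\bullet\}$ ($\bullet$ means no vertex is activated). Burning sets: $B_0=\{v_0\}$ (empty if $v_0=\bullet$), and $B_{n+1}=N_{G_{n+1}}[B_n]$ if $v_{n+1}=\bullet$, and $B_{n+1}=N_{G_{n+1}}[B_n]\cup\{v_{n+1}\}$ otherwise, where $N_G[X]$ is the closed neighbourhood of $X$ in $G$. The burning density is $\delta(\underline{G},\underline{v})=\lim_{n\to\infty}|B_n|/|V(G_n)|$ when the limit exists. -}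

module Defs where

open import Data.Nat using (ℕ; zero; suc; pred; _≤ᵇ_; _≡ᵇ_; _*_; _≤_)
open import Data.Bool using (Bool; true; false; _∧_; _∨_)
open import Data.Product using (_×_; _,_; ∃)
open import Data.Maybe using (Maybe; just; nothing)
open import Data.List using (List; length; filterᵇ; cartesianProduct; upTo)
open import Data.Integer using (+_)
open import Data.Rational using (ℚ; _/_; _-_; ∣_∣; _<_; 0ℚ; 1ℚ)

Vertex : Set
Vertex = ℕ × ℕ

-- A sequence of activated vertices: nothing plays the role of •.
Activation : Set
Activation = ℕ → Maybe Vertex

inBox : ℕ → Vertex → Bool
inBox n (x , y) = (x ≤ᵇ n) ∧ (y ≤ᵇ n)

vertices : ℕ → List Vertex
vertices n = cartesianProduct (upTo (suc n)) (upTo (suc n))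

isAt : Maybe Vertex → Vertex → Bool
isAt nothing p = false
isAt (just (a , b)) (x , y) = (a ≡ᵇ x) ∧ (b ≡ᵇ y)

-- Characteristic function of the burning set B_n for the sequence Q = (Q_n):
-- B_0 = {v_0},  B_{n+1} = N_{Q_{n+1}}[B_n] ∪ {v_{n+1}}.
-- A point p lies in N_{Q_{n+1}}[B_n] iff p ∈ [0,n+1]² and p ∈ B_n or some
-- point at L1-distance 1 from p lies in B_n (pred x = x when x = 0, which
-- only repeats the case p ∈ B_n).
burning : Activation → ℕ → Vertex → Bool
burning v zero p = isAt (v zero) p
burning v (suc n) (x , y) =
  (inBox (suc n) (x , y) ∧
    (burning v n (x , y) ∨ burning v n (suc x , y) ∨ burning v n (pred x , y)
     ∨ burning v n (x , suc y) ∨ burning v n (x , pred y)))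
  ∨ isAt (v (suc n)) (x , y)

burnCount : Activation → ℕ → ℕ
burnCount v n = length (filterᵇ (burning v n) (vertices n))

burnRatio : Activation → ℕ → ℚ
burnRatio v n = (+ burnCount v n) / (suc n * suc n)

HasDensity : Activation → ℚ → Set
HasDensity v d = ∀ (ε : ℚ) → 0ℚ < ε →
  ∃ λ N → ∀ n → N ≤ n → ∣ burnRatio v n - d ∣ < ε

module Submission where

-- Then the fire: a
-- fire lit at (m , m) in round m spreads one step per round, so in round
-- d + m it covers the L1-ball of radius d around (m , m) (`ball-burns`).
-- Since some diagonal vertex (j + i , j + i) with i ≤ k is lit for every j,
-- every vertex (x , y) with x + 3k ≤ n and y + 3k ≤ n burns in round n
-- (`interior-burns`).  So the unburnt vertices of Q_n lie in two border
-- strips of width 3k, and there are at most 6k(n+1) of them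
-- (`unburnt-bound`).  Finally, if e of the (n+1)² vertices are unburnt and
-- e·q < (n+1)², with q the denominator of ε, the burning ratio lies within ε
-- of 1 (`ratio-close-to-one`, computed in unnormalised rationals); this
-- holds as soon as n ≥ 6k·q.

open import Defs
open import Data.Nat using (ℕ; zero; suc; pred; _+_; _*_; _∸_; _≤_; _<_; _<ᵇ_; z≤n; s≤s; ∣_-_∣)
open import Data.Nat.Properties
open import Data.Nat.Tactic.RingSolver using (solve-∀)
open import Data.Bool using (Bool; true; false; not; _∨_; T)
open import Data.Bool.Properties using (T-∨; T-∧)
open import Data.Product using (_×_; _,_; proj₁; proj₂; ∃; Σ)
open import Data.Sum using (inj₁; inj₂)
open import Data.Maybe using (just; nothing)
open import Data.Empty using (⊥; ⊥-elim)
open import Data.List using (List; []; _∷_; length; filterᵇ; map; _++_; [_]; cartesianProduct; upTo)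
open import Data.List.Properties using (filter-++; length-++; length-upTo; upTo-∷ʳ)
open import Data.Integer as ℤ using (+_; +[1+_])
import Data.Integer.Properties as ℤP
import Data.Integer.Tactic.RingSolver as ℤ-Solver
open import Data.Rational as ℚ using (ℚ; mkℚ; 0ℚ; 1ℚ; ↧ₙ_; toℚᵘ; fromℚᵘ)
import Data.Rational.Properties as ℚP
open import Data.Rational.Unnormalised as ℚᵘ using (ℚᵘ; mkℚᵘ; *≡*; *<*) renaming (_≃_ to _≃ᵘ_)
import Data.Rational.Unnormalised.Properties as ℚᵘP
open import Function using (_∘_; Equivalence)
open import Relation.Binary.PropositionalEquality hiding ([_])

open Equivalence using (from)

private variable A B : Set

∨ˡ : ∀ {a} b → T a → T (a ∨ b)
∨ˡ b h = from T-∨ (inj₁ h)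

∨ʳ : ∀ a {b} → T b → T (a ∨ b)
∨ʳ a h = from T-∨ (inj₂ h)

count : (A → Bool) → List A → ℕ
count p xs = length (filterᵇ p xs)

count-complement : (p : A → Bool) (xs : List A) → count p xs + count (not ∘ p) xs ≡ length xs
count-complement p [] = refl
count-complement p (x ∷ xs) with p x
... | true = cong suc (count-complement p xs)
... | false = trans (+-suc (count p xs) _) (cong suc (count-complement p xs))

count-mono : (p q : A → Bool) → (∀ a → T (p a) → T (q a)) → (xs : List A) → count p xs ≤ count q xs
count-mono p q p⇒q [] = z≤n
count-mono p q p⇒q (x ∷ xs) with p x in px | q x in qx
... | true | true = s≤s (count-mono p q p⇒q xs)
... | true | false = ⊥-elim (subst T qx (p⇒q x (subst T (sym px) _)))
... | false | true = m≤n⇒m≤1+n (count-mono p q p⇒q xs)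
... | false | false = count-mono p q p⇒q xs

count-∨ : (p q : A → Bool) (xs : List A) → count (λ a → p a ∨ q a) xs ≤ count p xs + count q xs
count-∨ p q [] = z≤n
count-∨ p q (x ∷ xs) with p x | q x
... | true | true = s≤s (≤-trans (count-∨ p q xs) (+-monoʳ-≤ (count p xs) (n≤1+n _)))
... | true | false = s≤s (count-∨ p q xs)
... | false | true = ≤-trans (s≤s (count-∨ p q xs)) (≤-reflexive (sym (+-suc _ _)))
... | false | false = count-∨ p q xs

count-++ : (p : A → Bool) (xs ys : List A) → count p (xs ++ ys) ≡ count p xs + count p ys
count-++ p xs ys = trans (cong length (filter-++ _ xs ys)) (length-++ (filterᵇ p xs))

count-map : (p : B → Bool) (f : A → B) (xs : List A) → count p (map f xs) ≡ count (p ∘ f) xs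
count-map p f [] = refl
count-map p f (x ∷ xs) with p (f x)
... | true = cong suc (count-map p f xs)
... | false = count-map p f xs

count-true : (xs : List A) → count (λ _ → true) xs ≡ length xs
count-true [] = refl
count-true (x ∷ xs) = cong suc (count-true xs)

count-false : (xs : List A) → count (λ _ → false) xs ≡ 0
count-false [] = refl
count-false (x ∷ xs) = count-false xs

count-first : (p : A → Bool) (xs : List A) (ys : List B) →
              count (p ∘ proj₁) (cartesianProduct xs ys) ≡ count p xs * length ys
count-first p [] ys = refl
count-first p (x ∷ xs) ys = begin
  count (p ∘ proj₁) (map (x ,_) ys ++ cartesianProduct xs ys)  ≡⟨ count-++ (p ∘ proj₁) (map (x ,_) ys) _ ⟩
  count (p ∘ proj₁) (map (x ,_) ys) + rest                     ≡⟨ cong (_+ rest) (count-map (p ∘ proj₁) (x ,_) ys) ⟩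
  count (λ _ → p x) ys + rest                                  ≡⟨ row (p x) refl ⟩
  count p (x ∷ xs) * length ys                                 ∎
  where
  open ≡-Reasoning
  rest : ℕ
  rest = count (p ∘ proj₁) (cartesianProduct xs ys)
  row : (b : Bool) → p x ≡ b → count (λ _ → b) ys + rest ≡ count p (x ∷ xs) * length ys
  row true px rewrite px = cong₂ _+_ (count-true ys) (count-first p xs ys)
  row false px rewrite px = trans (cong (_+ rest) (count-false ys)) (count-first p xs ys)

count-second : (q : B → Bool) (xs : List A) (ys : List B) →
               count (q ∘ proj₂) (cartesianProduct xs ys) ≡ length xs * count q ys
count-second q [] ys = refl
count-second q (x ∷ xs) ys =
  trans (count-++ (q ∘ proj₂) (map (x ,_) ys) (cartesianProduct xs ys))
        (cong₂ _+_ (count-map (q ∘ proj₂) (x ,_) ys) (count-second q xs ys))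

length-cartesianProduct : (xs : List A) (ys : List B) → length (cartesianProduct xs ys) ≡ length xs * length ys
length-cartesianProduct xs ys = begin
  length (cartesianProduct xs ys)                 ≡⟨ count-true (cartesianProduct xs ys) ⟨
  count (λ _ → true) (cartesianProduct xs ys)     ≡⟨ count-second (λ _ → true) xs ys ⟩
  length xs * count (λ _ → true) ys               ≡⟨ cong (length xs *_) (count-true ys) ⟩
  length xs * length ys                           ∎
  where open ≡-Reasoning

strip-count : (m c N : ℕ) → count (λ x → m <ᵇ x + c) (upTo N) ≤ N + c ∸ suc m
strip-count m c zero = z≤n
strip-count m c (suc N) = begin
  count P (upTo (suc N))            ≡⟨ cong (count P) (upTo-∷ʳ N) ⟨
  count P (upTo N ++ [ N ])         ≡⟨ count-++ P (upTo N) [ N ] ⟩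
  count P (upTo N) + count P [ N ]  ≤⟨ last-step (m <ᵇ N + c) refl ⟩
  suc N + c ∸ suc m                 ∎
  where
  open ≤-Reasoning
  P : ℕ → Bool
  P x = m <ᵇ x + c
  last-step : (b : Bool) → (m <ᵇ N + c) ≡ b → count P (upTo N) + count P [ N ] ≤ suc N + c ∸ suc m
  last-step false eq rewrite eq =
    ≤-trans (≤-reflexive (+-identityʳ _)) (≤-trans (strip-count m c N) (∸-monoˡ-≤ (suc m) (n≤1+n (N + c))))
  last-step true eq rewrite eq = begin
    count P (upTo N) + 1    ≡⟨ +-comm _ 1 ⟩
    suc (count P (upTo N))  ≤⟨ s≤s (strip-count m c N) ⟩
    suc (N + c ∸ suc m)     ≡⟨ +-∸-assoc 1 (<ᵇ⇒< m (N + c) (subst T (sym eq) _)) ⟨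
    suc (N + c) ∸ suc m     ∎

strip-size : (n c : ℕ) → count (λ x → n <ᵇ x + c) (upTo (suc n)) ≤ c
strip-size n c = subst (count (λ x → n <ᵇ x + c) (upTo (suc n)) ≤_) (m+n∸m≡n (suc n) c) (strip-count n c (suc n))

Burns : Activation → ℕ → Vertex → Set
Burns v t p = T (burning v t p)

-- The five members of the closed neighbourhood of (x , y) examined by
-- `burning` (at the border, pred repeats the vertex itself).
data Source (x y : ℕ) : Vertex → Set where
  self  : Source x y (x , y)
  right : Source x y (suc x , y)
  left  : Source x y (pred x , y)
  above : Source x y (x , suc y)
  below : Source x y (x , pred y)

meetsNbhd : (Vertex → Bool) → ℕ → ℕ → Bool
meetsNbhd B x y = B (x , y) ∨ B (suc x , y) ∨ B (pred x , y) ∨ B (x , suc y) ∨ B (x , pred y)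

source-meets : ∀ {B x y q} → Source x y q → T (B q) → T (meetsNbhd B x y)
source-meets self  h = ∨ˡ _ h
source-meets {B} {x} {y} right h = ∨ʳ (B (x , y)) (∨ˡ _ h)
source-meets {B} {x} {y} left  h = ∨ʳ (B (x , y)) (∨ʳ (B (suc x , y)) (∨ˡ _ h))
source-meets {B} {x} {y} above h = ∨ʳ (B (x , y)) (∨ʳ (B (suc x , y)) (∨ʳ (B (pred x , y)) (∨ˡ _ h)))
source-meets {B} {x} {y} below h = ∨ʳ (B (x , y)) (∨ʳ (B (suc x , y)) (∨ʳ (B (pred x , y)) (∨ʳ (B (x , suc y)) h)))

spread : ∀ {v t x y q} → x ≤ suc t → y ≤ suc t → Source x y q → Burns v t q → Burns v (suc t) (x , y)
spread {v} {t} x≤ y≤ src burns =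
  ∨ˡ _ (from T-∧ (from T-∧ (≤⇒≤ᵇ x≤ , ≤⇒≤ᵇ y≤) , source-meets {B = burning v t} src burns))

ignite : ∀ {v m} → v m ≡ just (m , m) → Burns v m (m , m)
ignite {v} {zero} lit rewrite lit = _
ignite {v} {suc m} lit rewrite lit = ∨ʳ _ (from T-∧ (≡⇒≡ᵇ m m refl , ≡⇒≡ᵇ m m refl))

dist : Vertex → ℕ → ℕ
dist (x , y) m = ∣ x - m ∣ + ∣ y - m ∣

data Approach (m : ℕ) : ℕ → Set where
  arrived    : Approach m m
  from-above : ∀ x → ∣ suc x - m ∣ ≡ suc ∣ x - m ∣ → Approach m (suc x)
  from-below : ∀ x → ∣ x - m ∣ ≡ suc ∣ suc x - m ∣ → Approach m x

approach : ∀ m x → Approach m x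
approach zero    zero    = arrived
approach zero    (suc x) = from-above x (cong suc (sym (∣-∣-identityʳ x)))
approach (suc m) zero    = from-below zero refl
approach (suc m) (suc x) with approach m x
... | arrived           = arrived
... | from-above x' eq  = from-above (suc x') eq
... | from-below .x eq  = from-below (suc x) eq

dist-column : ∀ m y → dist (m , y) m ≡ ∣ y - m ∣
dist-column m y = cong (_+ ∣ y - m ∣) (∣n-n∣≡0 m)

on-column : ∀ m y {e} → ∣ y - m ∣ ≤ e → dist (m , y) m ≤ e
on-column m y = subst (_≤ _) (sym (dist-column m y))

off-column : ∀ m y {e} → dist (m , y) m ≤ e → ∣ y - m ∣ ≤ e
off-column m y = subst (_≤ _) (dist-column m y)

closer-source : ∀ m d x y → dist (x , y) m ≤ suc d → Σ Vertex λ q → Source x y q × dist q m ≤ d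
closer-source m d x y h with approach m x
... | from-above x' eq = (x' , y) , left , ≤-pred (subst (λ a → a + ∣ y - m ∣ ≤ suc d) eq h)
... | from-below .x eq = (suc x , y) , right , ≤-pred (subst (λ a → a + ∣ y - m ∣ ≤ suc d) eq h)
... | arrived with approach m y
...   | from-above y' eq = (m , y') , below , on-column m y' (≤-pred (subst (_≤ suc d) eq (off-column m y h)))
...   | from-below .y eq = (m , suc y) , above , on-column m (suc y) (≤-pred (subst (_≤ suc d) eq (off-column m y h)))
...   | arrived          = (m , m) , self , on-column m m (≤-trans (≤-reflexive (∣n-n∣≡0 m)) z≤n)

ball-burns : ∀ {v m} → v m ≡ just (m , m) → ∀ d p → dist p m ≤ d → Burns v (d + m) p
ball-burns {m = m} lit zero (x , y) h
  with ∣m-n∣≡0⇒m≡n {x} (m+n≡0⇒m≡0 _ (n≤0⇒n≡0 h)) | ∣m-n∣≡0⇒m≡n {y} (m+n≡0⇒n≡0 ∣ x - m ∣ (n≤0⇒n≡0 h))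
... | refl | refl = ignite lit
ball-burns {m = m} lit (suc d) (x , y) h with closer-source m d x y h
... | q , src , closer = spread (within x (m+n≤o⇒m≤o _ h)) (within y (m+n≤o⇒n≤o _ h)) src (ball-burns lit d q closer)
  where
  within : ∀ z → ∣ z - m ∣ ≤ suc d → z ≤ suc d + m
  within z near = ≤-trans (m≤∣m-n∣+n z m) (+-monoˡ-≤ m near)

burns-by : ∀ {v m n p} → v m ≡ just (m , m) → dist p m + m ≤ n → Burns v n p
burns-by {v} {m} {n} {p} lit h =
  subst (λ t → Burns v t p) (m∸n+n≡m (m+n≤o⇒n≤o (dist p m) h)) (ball-burns lit (n ∸ m) p (m+n≤o⇒m≤o∸n (dist p m) h))

DiagonalEvery : ℕ → Activation → Set
DiagonalEvery k v = ∀ j → ∃ λ i → i ≤ k × v (j + i) ≡ just (j + i , j + i)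

diagonal-every : ∀ {k v} → (∀ n → ∃ λ i → i ≤ k × v (n + i) ≢ nothing) →
                 (∀ n p → v n ≡ just p → p ≡ (n , n)) → DiagonalEvery k v
diagonal-every {v = v} active on-diagonal j with active j
... | i , i≤k , lit with v (j + i) in eq
...   | nothing = ⊥-elim (lit refl)
...   | just p  = i , i≤k , trans eq (cong just (on-diagonal (j + i) p eq))

dist-swap : ∀ x y m → dist (y , x) m ≡ dist (x , y) m
dist-swap x y m = +-comm ∣ y - m ∣ ∣ x - m ∣

reach-bound : ∀ {k x y i} → x ≤ y → i ≤ k → dist (x , y) (x + i) + (x + i) ≤ y + 3 * k
reach-bound {k} {x} {y} {i} x≤y i≤k = begin
  ∣ x - x + i ∣ + ∣ y - x + i ∣ + (x + i)       ≡⟨ cong (λ a → a + ∣ y - x + i ∣ + (x + i)) (∣m-m+n∣≡n x i) ⟩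
  i + ∣ y - x + i ∣ + (x + i)                   ≤⟨ +-monoˡ-≤ (x + i) (+-monoʳ-≤ i (∣-∣-triangle y x (x + i))) ⟩
  i + (∣ y - x ∣ + ∣ x - x + i ∣) + (x + i)     ≡⟨ cong₂ (λ a b → i + (a + b) + (x + i)) (m≤n⇒∣n-m∣≡n∸m x≤y) (∣m-m+n∣≡n x i) ⟩
  i + (y ∸ x + i) + (x + i)                     ≡⟨ regroup (y ∸ x) x i ⟩
  y ∸ x + x + 3 * i                             ≡⟨ cong (_+ 3 * i) (m∸n+n≡m x≤y) ⟩
  y + 3 * i                                     ≤⟨ +-monoʳ-≤ y (*-monoʳ-≤ 3 i≤k) ⟩
  y + 3 * k                                     ∎
  where
  open ≤-Reasoning
  regroup : ∀ a x i → i + (a + i) + (x + i) ≡ a + x + 3 * i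
  regroup = solve-∀

interior-burns : ∀ {k v} → DiagonalEvery k v → ∀ {n x y} → x + 3 * k ≤ n → y + 3 * k ≤ n → Burns v n (x , y)
interior-burns {k} every {n} {x} {y} x-inner y-inner with ≤-total x y
... | inj₁ x≤y with every x
...   | i , i≤k , lit = burns-by lit (≤-trans (reach-bound x≤y i≤k) y-inner)
interior-burns {k} every {n} {x} {y} x-inner y-inner | inj₂ y≤x with every y
...   | i , i≤k , lit =
  burns-by lit (subst (λ a → a + (y + i) ≤ n) (dist-swap x y (y + i)) (≤-trans (reach-bound y≤x i≤k) x-inner))

nearEdge : ℕ → ℕ → ℕ → Bool
nearEdge n c x = n <ᵇ x + c

unburnt : Activation → ℕ → ℕ
unburnt v n = count (not ∘ burning v n) (vertices n)

burn-split : ∀ v n → burnCount v n + unburnt v n ≡ suc n * suc n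
burn-split v n = begin
  burnCount v n + unburnt v n                    ≡⟨ count-complement (burning v n) (vertices n) ⟩
  length (vertices n)                            ≡⟨ length-cartesianProduct (upTo (suc n)) (upTo (suc n)) ⟩
  length (upTo (suc n)) * length (upTo (suc n))  ≡⟨ cong₂ _*_ (length-upTo (suc n)) (length-upTo (suc n)) ⟩
  suc n * suc n                                  ∎
  where open ≡-Reasoning

unburnt-near-edge : ∀ {k v} → DiagonalEvery k v → ∀ n p → T (not (burning v n p)) →
                    T (nearEdge n (3 * k) (proj₁ p) ∨ nearEdge n (3 * k) (proj₂ p))
unburnt-near-edge {k} {v} every n (x , y) not-burning
  with nearEdge n (3 * k) x in x-edge | nearEdge n (3 * k) y in y-edge
... | true  | _     = _
... | false | true  = _
... | false | false = ⊥-elim (not-T (burning v n (x , y)) not-burning (interior-burns every (inner x x-edge) (inner y y-edge)))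
  where
  inner : ∀ z → nearEdge n (3 * k) z ≡ false → z + 3 * k ≤ n
  inner z edge = ≮⇒≥ (λ lt → subst T edge (<⇒<ᵇ lt))
  not-T : ∀ b → T (not b) → T b → ⊥
  not-T false _ ()

unburnt-bound : ∀ {k v} → DiagonalEvery k v → ∀ n → unburnt v n ≤ 6 * k * suc n
unburnt-bound {k} {v} every n = begin
  unburnt v n                                       ≤⟨ count-mono _ _ (unburnt-near-edge every n) V ⟩
  count (λ p → E (proj₁ p) ∨ E (proj₂ p)) V          ≤⟨ count-∨ (E ∘ proj₁) (E ∘ proj₂) V ⟩
  count (E ∘ proj₁) V + count (E ∘ proj₂) V          ≡⟨ cong₂ _+_ (count-first E U U) (count-second E U U) ⟩
  count E U * length U + length U * count E U        ≡⟨ cong₂ (λ a b → count E U * a + b * count E U) (length-upTo (suc n)) (length-upTo (suc n)) ⟩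
  count E U * suc n + suc n * count E U              ≤⟨ +-mono-≤ (*-monoˡ-≤ (suc n) (strip-size n (3 * k))) (*-monoʳ-≤ (suc n) (strip-size n (3 * k))) ⟩
  3 * k * suc n + suc n * (3 * k)                    ≡⟨ double k (suc n) ⟩
  6 * k * suc n                                      ∎
  where
  open ≤-Reasoning
  U : List ℕ
  U = upTo (suc n)
  V : List Vertex
  V = vertices n
  E : ℕ → Bool
  E = nearEdge n (3 * k)
  double : ∀ k s → 3 * k * s + s * (3 * k) ≡ 6 * k * s
  double = solve-∀

distance-to-one : ∀ c e d → suc d ≡ c + e → ℚᵘ.∣ mkℚᵘ (+ c) d ℚᵘ.- ℚᵘ.1ℚᵘ ∣ ≃ᵘ mkℚᵘ (+ e) d
distance-to-one c e d total = *≡* (cong₂ (λ a b → + a ℤ.* b) numerator (cong (λ z → + suc z) (sym (*-identityʳ d))))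
  where
  numerator : ℤ.∣ + c ℤ.* + 1 ℤ.+ ℤ.- (+ 1) ℤ.* + suc d ∣ ≡ e
  numerator = begin
    ℤ.∣ + c ℤ.* + 1 ℤ.+ ℤ.- (+ 1) ℤ.* + suc d ∣         ≡⟨ cong (λ z → ℤ.∣ + c ℤ.* + 1 ℤ.+ ℤ.- (+ 1) ℤ.* z ∣) (trans (cong +_ total) (ℤP.pos-+ c e)) ⟩
    ℤ.∣ + c ℤ.* + 1 ℤ.+ ℤ.- (+ 1) ℤ.* (+ c ℤ.+ + e) ∣   ≡⟨ cong ℤ.∣_∣ (cancel (+ c) (+ e)) ⟩
    ℤ.∣ ℤ.- (+ e) ∣                                    ≡⟨ ℤP.∣-i∣≡∣i∣ (+ e) ⟩
    e                                                 ∎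
    where
    open ≡-Reasoning
    cancel : ∀ a b → a ℤ.* + 1 ℤ.+ ℤ.- (+ 1) ℤ.* (a ℤ.+ b) ≡ ℤ.- b
    cancel = ℤ-Solver.solve-∀

below-positive : ∀ e d ε → ℚ.Positive ε → e * ↧ₙ ε < suc d → mkℚᵘ (+ e) d ℚᵘ.< toℚᵘ ε
below-positive e d (mkℚ +[1+ p ] dε _) _ small =
  *<* (subst₂ ℤ._<_ (ℤP.pos-* e (suc dε)) (ℤP.pos-* (suc p) (suc d)) (ℤ.+<+ (<-≤-trans small (m≤n*m (suc d) (suc p)))))

ratio-close-to-one : ∀ c e d → suc d ≡ c + e → ∀ ε → 0ℚ ℚ.< ε → e * ↧ₙ ε < suc d →
                     ℚ.∣ + c ℚ./ suc d ℚ.- 1ℚ ∣ ℚ.< ε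
ratio-close-to-one c e d total ε ε>0 small = ℚP.toℚᵘ-cancel-< (begin-strict
  toℚᵘ ℚ.∣ r ℚ.- 1ℚ ∣                        ≃⟨ ℚP.toℚᵘ-homo-∣-∣ (r ℚ.- 1ℚ) ⟩
  ℚᵘ.∣ toℚᵘ (r ℚ.- 1ℚ) ∣                     ≃⟨ ℚᵘP.∣-∣-cong (ℚP.toℚᵘ-homo-+ r (ℚ.- 1ℚ)) ⟩
  ℚᵘ.∣ toℚᵘ r ℚᵘ.+ toℚᵘ (ℚ.- 1ℚ) ∣            ≃⟨ ℚᵘP.∣-∣-cong (ℚᵘP.+-cong (ℚP.toℚᵘ-fromℚᵘ u) (ℚP.toℚᵘ-homo‿- 1ℚ)) ⟩
  ℚᵘ.∣ u ℚᵘ.- ℚᵘ.1ℚᵘ ∣                        ≃⟨ distance-to-one c e d total ⟩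
  mkℚᵘ (+ e) d                               <⟨ below-positive e d ε (ℚ.positive ε>0) small ⟩
  toℚᵘ ε                                     ∎)
  where
  open ℚᵘP.≤-Reasoning
  u : ℚᵘ
  u = mkℚᵘ (+ c) d
  r : ℚ
  r = fromℚᵘ u

-- Lemma 7.  With q the denominator of ε, from round 6k·q on the at most
-- 6k(n+1) unburnt vertices satisfy e·q < (n+1)², so `ratio-close-to-one`
-- applies.
lemma7 : (k : ℕ) → 1 ≤ k → (v : Activation)
       → (∀ n → ∃ λ i → i ≤ k × v (n + i) ≢ nothing)
       → (∀ n p → v n ≡ just p → p ≡ (n , n))
       → HasDensity v 1ℚ
lemma7 k _ v active on-diagonal ε ε>0 = 6 * k * ↧ₙ ε , close
  where
  close : ∀ n → 6 * k * ↧ₙ ε ≤ n → ℚ.∣ burnRatio v n ℚ.- 1ℚ ∣ ℚ.< ε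
  close n late = ratio-close-to-one (burnCount v n) (unburnt v n) _ (sym (burn-split v n)) ε ε>0 few-unburnt
    where
    reorder : ∀ a s q → a * s * q ≡ a * q * s
    reorder = solve-∀
    few-unburnt : unburnt v n * ↧ₙ ε < suc n * suc n
    few-unburnt = begin-strict
      unburnt v n * ↧ₙ ε            ≤⟨ *-monoˡ-≤ (↧ₙ ε) (unburnt-bound (diagonal-every active on-diagonal) n) ⟩
      6 * k * suc n * ↧ₙ ε          ≡⟨ reorder (6 * k) (suc n) (↧ₙ ε) ⟩
      6 * k * ↧ₙ ε * suc n          <⟨ *-monoˡ-< (suc n) (s≤s late) ⟩
      suc n * suc n                 ∎
      where open ≤-Reasoning
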